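{- Let $p=k/n$ for a fixed constant $k>0$. Then the average complexity $\mathbb{T}(n,p)$ of exhaustive search for \textsc{max independent set} on $\mathcal{G}(n,p)$ random graphs is exponential in $n$.
   Context: \textsc{max independent set}: given a graph $G=(V,E)$, find a maximum-cardinality set $V'\subseteq V$ containing no edge of $G$. Random model $\mathcal{G}(n,p)$: a graph on $n$ vertices in which each of the $\binom n2$ pairs of vertices is an edge with probability $p$, independently of all other pairs. Exhaustive search (branch-and-bound pruning only by infeasibility): the vertices are handled in a fixed order $v_1,\dots,v_n$; the search tree has a root at level $0$ representing the empty partial solution, and a node at level $i-1$ representing an independent set $S\subseteq\{v_1,\dots,v_{i-1}\}$ has as children (at level $i$) the partial solutions $S$ and $S\cup\{v_i\}$, a child being kept only if it is an independent set of $G$. $\mathbb{T}(n,p)$ denotes the expected number of nodes of this search tree (the average running time) when $G$ is drawn from $\mathcal{G}(n,p)$.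
   Formalization: The constant k in $p=k/n$ ranges over the positive rationals instead of the positive reals. -}

module Defs where

open import Data.Bool using (Bool; true; false; _∧_; _∨_; not; if_then_else_)
open import Data.Nat as ℕ using (ℕ; zero; suc)
open import Data.Integer using (+_)
open import Data.Unit using (⊤; tt)
open import Data.Product using (_×_; _,_)
open import Data.List using (List; []; _∷_; concatMap; map; length)
open import Data.Vec using (Vec; []; _∷_; _∷ʳ_)
open import Data.Rational using (ℚ; 0ℚ; 1ℚ; _+_; _*_; _-_; _/_)

-- A graph on (suc n) vertices is a graph on v₁,…,vₙ together with the
-- adjacency row of the new vertex v_{n+1}: a Vec Bool n whose j-th entry
-- (0-based) says whether v_{n+1} v_{j+1} is an edge.  Every simple
-- undirected graph on n labelled vertices has exactly one representation.

Graph : ℕ → Set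
Graph zero    = ⊤
Graph (suc n) = Graph n × Vec Bool n

allVecs : (n : ℕ) → List (Vec Bool n)
allVecs zero    = [] ∷ []
allVecs (suc n) = concatMap (λ v → (false ∷ v) ∷ (true ∷ v) ∷ []) (allVecs n)

allGraphs : (n : ℕ) → List (Graph n)
allGraphs zero    = tt ∷ []
allGraphs (suc n) =
  concatMap (λ G → map (λ row → (G , row)) (allVecs n)) (allGraphs n)

-- Exhaustive search tree.  A partial solution at level i is a subset S of
-- {v₁,…,vᵢ}, represented as a Vec Bool i (entry j ↔ v_{j+1} ∈ S).

conflict : {n : ℕ} → Vec Bool n → Vec Bool n → Bool
conflict []       []       = false
conflict (s ∷ ss) (r ∷ rs) = (s ∧ r) ∨ conflict ss rs

-- children of a node S at level i, given the adjacency row of v_{i+1}: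
-- S (always independent) and S ∪ {v_{i+1}} (kept only if independent).
children : {n : ℕ} → Vec Bool n → Vec Bool n → List (Vec Bool (suc n))
children row S =
  (S ∷ʳ false) ∷ (if conflict S row then [] else ((S ∷ʳ true) ∷ []))

levelNodes : {n : ℕ} → Graph n → List (Vec Bool n)
levelNodes {zero}  tt        = [] ∷ []
levelNodes {suc n} (G , row) = concatMap (children row) (levelNodes G)

treeSize : {n : ℕ} → Graph n → ℕ
treeSize {zero}  tt        = 1
treeSize {suc n} (G , row) = treeSize G ℕ.+ length (levelNodes (G , row))

rowWeight : ℚ → {n : ℕ} → Vec Bool n → ℚ
rowWeight p []       = 1ℚ
rowWeight p (b ∷ bs) = (if b then p else (1ℚ - p)) * rowWeight p bs

graphWeight : ℚ → {n : ℕ} → Graph n → ℚ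
graphWeight p {zero}  tt        = 1ℚ
graphWeight p {suc n} (G , row) = graphWeight p G * rowWeight p row

sumℚ : List ℚ → ℚ
sumℚ []       = 0ℚ
sumℚ (x ∷ xs) = x + sumℚ xs

fromℕ : ℕ → ℚ
fromℕ m = + m / 1

𝕋 : ℕ → ℚ → ℚ
𝕋 n p = sumℚ (map (λ G → graphWeight p G * fromℕ (treeSize G)) (allGraphs n))

-- p = k/n  (junk value 0 at n = 0, irrelevant for large n)

kOver : ℚ → ℕ → ℚ
kOver k zero    = 0ℚ
kOver k (suc m) = k * (+ 1 / suc m)

_^_ : ℚ → ℕ → ℚ
x ^ zero  = 1ℚ
x ^ suc m = x * (x ^ m)

{-# OPTIONS --safe #-}
module Submission where

-- A node S at level m of the search tree always keeps its child S, and keeps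
-- S ∪ {v_{m+1}} exactly when v_{m+1} has no neighbour in S, which happens with
-- probability (1-p)^|S| ≥ (1-p)^n.  Hence each level is in expectation at least
-- 1 + (1-p)^n times larger than the previous one, and the last level alone has
-- expected size ≥ (1 + (1-p)^n)^n.  For p = k/n this factor stays bounded away
-- from 1: for an integer K ≥ k, cover n by 2K blocks of ⌊n/2K⌋ + 1 factors of
-- 1 - p; by Bernoulli's inequality each block is ≥ ¼, so (1-p)^n ≥ ¼^{2K}.
-- Conversely level i has at most 2^i nodes, so the tree has at most 4^n.

open import Algebra.Bundles using (CommutativeMonoid)
import Algebra.Properties.CommutativeSemigroup as CommSemigroupProperties
open import Data.Bool using (Bool; true; false; not)
open import Data.Integer as ℤ using (-[1+_])
import Data.Integer.Properties as ℤ
open import Data.List using (List; []; _∷_; _++_; concatMap; map; length)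
import Data.List.Properties as List
open import Data.Nat as ℕ using (ℕ; zero; suc; NonZero) renaming (_≤_ to _≤ℕ_)
open import Data.Nat.Coprimality using (1-coprimeTo) renaming (sym to coprime-sym)
open import Data.Nat.DivMod using (m/n*n≤m; m%n<n; m≡m%n+[m/n]*n)
import Data.Nat.Properties as ℕ
open import Data.Product using (Σ; ∃-syntax; _×_; _,_)
open import Data.Rational
  using (ℚ; mkℚ; 0ℚ; 1ℚ; ½; _+_; _*_; -_; _-_; _/_; _≤_; _<_; *≤*; toℚᵘ; positive; nonNegative)
open import Data.Rational.Properties
open import Data.Rational.Solver using (module +-*-Solver)
import Data.Rational.Unnormalised as ℚᵘ
import Data.Rational.Unnormalised.Properties as ℚᵘ
open import Data.Vec using (Vec; []; _∷_)
open import Function using (_∘_)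
open import Relation.Binary.PropositionalEquality
  using (_≡_; refl; sym; trans; cong; cong₂; subst; module ≡-Reasoning)

open import Defs

private variable
  A B : Set

open CommSemigroupProperties (CommutativeMonoid.commutativeSemigroup +-0-commutativeMonoid)
  using () renaming (interchange to +-interchange)
open CommSemigroupProperties (CommutativeMonoid.commutativeSemigroup *-1-commutativeMonoid)
  using () renaming (x∙yz≈y∙xz to *-leftComm)

fromℕ≡mkℚ : ∀ n → fromℕ n ≡ mkℚ (ℤ.+ n) 0 (coprime-sym (1-coprimeTo n))
fromℕ≡mkℚ n = normalize-coprime (coprime-sym (1-coprimeTo n))

-- fromℕ normalises through a gcd that does not reduce on a variable, so
-- additivity is checked on unnormalised fractions.
fromℕ-+ : ∀ m n → fromℕ (m ℕ.+ n) ≡ fromℕ m + fromℕ n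
fromℕ-+ m n = toℚᵘ-injective (begin
  toℚᵘ (fromℕ (m ℕ.+ n))                         ≡⟨ cong toℚᵘ (fromℕ≡mkℚ (m ℕ.+ n)) ⟩
  ℚᵘ.mkℚᵘ (ℤ.+ m ℤ.+ ℤ.+ n) 0                    ≈⟨ ℚᵘ.*≡* (cong (ℤ._* ℤ.+ 1) (cong₂ ℤ._+_
                                                      (sym (ℤ.*-identityʳ (ℤ.+ m))) (sym (ℤ.*-identityʳ (ℤ.+ n))))) ⟩
  ℚᵘ.mkℚᵘ (ℤ.+ m) 0 ℚᵘ.+ ℚᵘ.mkℚᵘ (ℤ.+ n) 0       ≡⟨ cong₂ ℚᵘ._+_ (cong toℚᵘ (fromℕ≡mkℚ m)) (cong toℚᵘ (fromℕ≡mkℚ n)) ⟨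
  toℚᵘ (fromℕ m) ℚᵘ.+ toℚᵘ (fromℕ n)             ≈⟨ ℚᵘ.≃-sym (toℚᵘ-homo-+ (fromℕ m) (fromℕ n)) ⟩
  toℚᵘ (fromℕ m + fromℕ n)                       ∎)
  where open ℚᵘ.≃-Reasoning

fromℕ-* : ∀ m n → fromℕ (m ℕ.* n) ≡ fromℕ m * fromℕ n
fromℕ-* zero    n = sym (*-zeroˡ (fromℕ n))
fromℕ-* (suc m) n = begin
  fromℕ (n ℕ.+ m ℕ.* n)             ≡⟨ fromℕ-+ n (m ℕ.* n) ⟩
  fromℕ n + fromℕ (m ℕ.* n)         ≡⟨ cong (fromℕ n +_) (fromℕ-* m n) ⟩
  fromℕ n + fromℕ m * fromℕ n       ≡⟨ cong (_+ fromℕ m * fromℕ n) (*-identityˡ (fromℕ n)) ⟨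
  1ℚ * fromℕ n + fromℕ m * fromℕ n  ≡⟨ *-distribʳ-+ (fromℕ n) 1ℚ (fromℕ m) ⟨
  (1ℚ + fromℕ m) * fromℕ n          ≡⟨ cong (_* fromℕ n) (fromℕ-+ 1 m) ⟨
  fromℕ (suc m) * fromℕ n           ∎
  where open ≡-Reasoning

fromℕ-mono-≤ : ∀ {m n} → m ≤ℕ n → fromℕ m ≤ fromℕ n
fromℕ-mono-≤ {m} {n} m≤n rewrite fromℕ≡mkℚ m | fromℕ≡mkℚ n =
  *≤* (ℤ.*-monoʳ-≤-nonNeg (ℤ.+ 1) (ℤ.+≤+ m≤n))

fromℕ-nonNeg : ∀ n → 0ℚ ≤ fromℕ n
fromℕ-nonNeg n = fromℕ-mono-≤ {0} {n} ℕ.z≤n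

archimedean : ∀ k → ∃[ K ] k ≤ fromℕ K
archimedean (mkℚ -[1+ _ ] _ _)    = 0 , *≤* ℤ.-≤+
archimedean k@(mkℚ (ℤ.+ a) _ _) =
  a , subst (k ≤_) (sym (fromℕ≡mkℚ a)) (*≤* (ℤ.*-monoˡ-≤-nonNeg (ℤ.+ a) (ℤ.+≤+ (ℕ.s≤s ℕ.z≤n))))

[1/n]*n≡1 : ∀ m → (ℤ.+ 1 / suc m) * fromℕ (suc m) ≡ 1ℚ
[1/n]*n≡1 m rewrite normalize-coprime (1-coprimeTo (suc m)) | fromℕ≡mkℚ (suc m) =
  *-inverseˡ (mkℚ (ℤ.+ suc m) 0 (coprime-sym (1-coprimeTo (suc m))))

p≤p+q : ∀ {p q} → 0ℚ ≤ q → p ≤ p + q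
p≤p+q {p} 0≤q = ≤-trans (≤-reflexive (sym (+-identityʳ p))) (+-monoʳ-≤ p 0≤q)

*-nonNeg : ∀ {p q} → 0ℚ ≤ p → 0ℚ ≤ q → 0ℚ ≤ p * q
*-nonNeg {p} {q} 0≤p 0≤q =
  nonNegative⁻¹ (p * q) {{nonNeg*nonNeg⇒nonNeg p {{nonNegative 0≤p}} q {{nonNegative 0≤q}}}}

module _ {p q r : ℚ} where
  *-monoˡ-≤-0≤ : 0ℚ ≤ r → p ≤ q → r * p ≤ r * q
  *-monoˡ-≤-0≤ 0≤r = *-monoˡ-≤-nonNeg r {{nonNegative 0≤r}}

  *-monoʳ-≤-0≤ : 0ℚ ≤ r → p ≤ q → p * r ≤ q * r
  *-monoʳ-≤-0≤ 0≤r = *-monoʳ-≤-nonNeg r {{nonNegative 0≤r}}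

*-mono-≤-0≤ : ∀ {p q r s} → 0ℚ ≤ p → 0ℚ ≤ r → p ≤ q → r ≤ s → p * r ≤ q * s
*-mono-≤-0≤ 0≤p 0≤r p≤q r≤s = ≤-trans (*-monoʳ-≤-0≤ 0≤r p≤q) (*-monoˡ-≤-0≤ (≤-trans 0≤p p≤q) r≤s)

p≤1⇒0≤1-p : ∀ {p} → p ≤ 1ℚ → 0ℚ ≤ 1ℚ - p
p≤1⇒0≤1-p {p} p≤1 = ≤-trans (≤-reflexive (sym (+-inverseʳ p))) (+-monoˡ-≤ (- p) p≤1)

0≤p⇒1-p≤1 : ∀ {p} → 0ℚ ≤ p → 1ℚ - p ≤ 1ℚ
0≤p⇒1-p≤1 0≤p = ≤-trans (+-monoʳ-≤ 1ℚ (neg-antimono-≤ 0≤p)) (≤-reflexive (+-identityʳ 1ℚ))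

p≤½⇒½≤1-p : ∀ {p} → p ≤ ½ → ½ ≤ 1ℚ - p
p≤½⇒½≤1-p p≤½ = +-monoʳ-≤ 1ℚ (neg-antimono-≤ p≤½)

½≤1 : ½ ≤ 1ℚ
½≤1 = *≤* (ℤ.+≤+ (ℕ.s≤s ℕ.z≤n))

¼ : ℚ
¼ = ½ * ½

module _ {x : ℚ} where
  ^-nonNeg : ∀ n → 0ℚ ≤ x → 0ℚ ≤ x ^ n
  ^-nonNeg zero    _   = nonNegative⁻¹ 1ℚ
  ^-nonNeg (suc n) 0≤x = *-nonNeg 0≤x (^-nonNeg n 0≤x)

  ^-pos : ∀ n → 0ℚ < x → 0ℚ < x ^ n
  ^-pos zero    _   = positive⁻¹ 1ℚ
  ^-pos (suc n) 0<x = positive⁻¹ (x * x ^ n)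
    {{pos*pos⇒pos x {{positive 0<x}} (x ^ n) {{positive (^-pos n 0<x)}}}}

  ^-distribˡ-+-* : ∀ m n → x ^ (m ℕ.+ n) ≡ x ^ m * x ^ n
  ^-distribˡ-+-* zero    n = sym (*-identityˡ (x ^ n))
  ^-distribˡ-+-* (suc m) n = trans (cong (x *_) (^-distribˡ-+-* m n)) (sym (*-assoc x (x ^ m) (x ^ n)))

  ^-*-assoc : ∀ m n → (x ^ m) ^ n ≡ x ^ (m ℕ.* n)
  ^-*-assoc m zero    rewrite ℕ.*-zeroʳ m = refl
  ^-*-assoc m (suc n) rewrite ℕ.*-suc m n =
    trans (cong (x ^ m *_) (^-*-assoc m n)) (sym (^-distribˡ-+-* m (m ℕ.* n)))

1^n≡1 : ∀ n → 1ℚ ^ n ≡ 1ℚ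
1^n≡1 zero    = refl
1^n≡1 (suc n) = trans (*-identityˡ (1ℚ ^ n)) (1^n≡1 n)

^-monoˡ-≤ : ∀ {x y} n → 0ℚ ≤ x → x ≤ y → x ^ n ≤ y ^ n
^-monoˡ-≤ zero    _   _   = ≤-refl
^-monoˡ-≤ (suc n) 0≤x x≤y = *-mono-≤-0≤ 0≤x (^-nonNeg n 0≤x) x≤y (^-monoˡ-≤ n 0≤x x≤y)

^-antimonoʳ-≤ : ∀ {x m n} → 0ℚ ≤ x → x ≤ 1ℚ → m ≤ℕ n → x ^ n ≤ x ^ m
^-antimonoʳ-≤ {x} {m} 0≤x x≤1 m≤n with ℕ.m≤n⇒∃[o]m+o≡n m≤n
... | o , refl = begin
  x ^ (m ℕ.+ o)   ≡⟨ ^-distribˡ-+-* m o ⟩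
  x ^ m * x ^ o   ≤⟨ *-monoˡ-≤-0≤ (^-nonNeg m 0≤x) (^-monoˡ-≤ o 0≤x x≤1) ⟩
  x ^ m * 1ℚ ^ o  ≡⟨ cong (x ^ m *_) (1^n≡1 o) ⟩
  x ^ m * 1ℚ      ≡⟨ *-identityʳ (x ^ m) ⟩
  x ^ m           ∎
  where open ≤-Reasoning

fromℕ-^ : ∀ m n → fromℕ (m ℕ.^ n) ≡ fromℕ m ^ n
fromℕ-^ m zero    = refl
fromℕ-^ m (suc n) = trans (fromℕ-* m (m ℕ.^ n)) (cong (fromℕ m *_) (fromℕ-^ m n))

bernoulli : ∀ {p} → 0ℚ ≤ p → p ≤ 1ℚ → ∀ t → 1ℚ - fromℕ t * p ≤ (1ℚ - p) ^ t
bernoulli {p} _   _   zero    = ≤-reflexive (cong (λ x → 1ℚ - x) (*-zeroˡ p))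
bernoulli {p} 0≤p p≤1 (suc t) = begin
  1ℚ - fromℕ (1 ℕ.+ t) * p                    ≡⟨ cong (λ x → 1ℚ - x * p) (fromℕ-+ 1 t) ⟩
  1ℚ - (1ℚ + fromℕ t) * p                     ≤⟨ p≤p+q (*-nonNeg (fromℕ-nonNeg t) (*-nonNeg 0≤p 0≤p)) ⟩
  1ℚ - (1ℚ + fromℕ t) * p + fromℕ t * (p * p) ≡⟨ factorise (fromℕ t) ⟩
  (1ℚ - p) * (1ℚ - fromℕ t * p)               ≤⟨ *-monoˡ-≤-0≤ (p≤1⇒0≤1-p p≤1) (bernoulli 0≤p p≤1 t) ⟩
  (1ℚ - p) * (1ℚ - p) ^ t                     ∎
  where
  open ≤-Reasoning
  factorise : ∀ x → 1ℚ - (1ℚ + x) * p + x * (p * p) ≡ (1ℚ - p) * (1ℚ - x * p)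
  factorise x = solve 2 (λ x p → con 1ℚ :- (con 1ℚ :+ x) :* p :+ x :* (p :* p) := (con 1ℚ :- p) :* (con 1ℚ :- x :* p))
    refl x p
    where open +-*-Solver

∑ : List A → (A → ℚ) → ℚ
∑ xs f = sumℚ (map f xs)

∑-++ : ∀ (xs ys : List A) f → ∑ (xs ++ ys) f ≡ ∑ xs f + ∑ ys f
∑-++ []       ys f = sym (+-identityˡ (∑ ys f))
∑-++ (x ∷ xs) ys f = trans (cong (f x +_) (∑-++ xs ys f)) (sym (+-assoc (f x) (∑ xs f) (∑ ys f)))

∑-cong : ∀ (xs : List A) {f g} → (∀ x → f x ≡ g x) → ∑ xs f ≡ ∑ xs g
∑-cong []       _   = refl
∑-cong (x ∷ xs) f≡g = cong₂ _+_ (f≡g x) (∑-cong xs f≡g)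

∑-mono-≤ : ∀ (xs : List A) {f g} → (∀ x → f x ≤ g x) → ∑ xs f ≤ ∑ xs g
∑-mono-≤ []       _   = ≤-refl
∑-mono-≤ (x ∷ xs) f≤g = +-mono-≤ (f≤g x) (∑-mono-≤ xs f≤g)

∑-*ˡ : ∀ (xs : List A) c f → ∑ xs (λ x → c * f x) ≡ c * ∑ xs f
∑-*ˡ []       c f = sym (*-zeroʳ c)
∑-*ˡ (x ∷ xs) c f = trans (cong (c * f x +_) (∑-*ˡ xs c f)) (sym (*-distribˡ-+ c (f x) (∑ xs f)))

∑-+ : ∀ (xs : List A) f g → ∑ xs (λ x → f x + g x) ≡ ∑ xs f + ∑ xs g
∑-+ []       f g = refl
∑-+ (x ∷ xs) f g = trans (cong (f x + g x +_) (∑-+ xs f g)) (+-interchange (f x) (g x) (∑ xs f) (∑ xs g))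

∑-concatMap : ∀ (h : A → List B) (xs : List A) f → ∑ (concatMap h xs) f ≡ ∑ xs (λ x → ∑ (h x) f)
∑-concatMap h []       f = refl
∑-concatMap h (x ∷ xs) f = trans (∑-++ (h x) (concatMap h xs) f) (cong (∑ (h x) f +_) (∑-concatMap h xs f))

∑-map : ∀ (h : A → B) (xs : List A) f → ∑ (map h xs) f ≡ ∑ xs (λ x → f (h x))
∑-map h []       f = refl
∑-map h (x ∷ xs) f = cong (f (h x) +_) (∑-map h xs f)

module Weighted {A : Set} (w : A → ℚ) (xs : List A) where
  𝔼 : (A → ℚ) → ℚ
  𝔼 f = ∑ xs λ x → w x * f x

  𝔼-cong : ∀ {f g} → (∀ x → f x ≡ g x) → 𝔼 f ≡ 𝔼 g
  𝔼-cong f≡g = ∑-cong xs λ x → cong (w x *_) (f≡g x)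

  𝔼-mono-≤ : (∀ x → 0ℚ ≤ w x) → ∀ {f g} → (∀ x → f x ≤ g x) → 𝔼 f ≤ 𝔼 g
  𝔼-mono-≤ 0≤w f≤g = ∑-mono-≤ xs λ x → *-monoˡ-≤-0≤ (0≤w x) (f≤g x)

  𝔼-*ˡ : ∀ c f → 𝔼 (λ x → c * f x) ≡ c * 𝔼 f
  𝔼-*ˡ c f = trans (∑-cong xs {g = λ x → c * (w x * f x)} λ x → *-leftComm (w x) c (f x))
                   (∑-*ˡ xs c λ x → w x * f x)

  𝔼-+ : ∀ f g → 𝔼 (λ x → f x + g x) ≡ 𝔼 f + 𝔼 g
  𝔼-+ f g = trans (∑-cong xs {g = λ x → w x * f x + w x * g x} λ x → *-distribˡ-+ (w x) (f x) (g x))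
                  (∑-+ xs (λ x → w x * f x) (λ x → w x * g x))

addable : ∀ {m} → Vec Bool m → Vec Bool m → Bool
addable S row = not (conflict S row)

𝟙 : Bool → ℚ
𝟙 true  = 1ℚ
𝟙 false = 0ℚ

levelSize : ∀ {m} → Graph m → ℚ
levelSize G = fromℕ (length (levelNodes G))

fromℕ-length-children : ∀ {m} (row S : Vec Bool m) → fromℕ (length (children row S)) ≡ 1ℚ + 𝟙 (addable S row)
fromℕ-length-children row S with conflict S row
... | true  = refl
... | false = refl

fromℕ-length-++ : ∀ (xs ys : List A) → fromℕ (length (xs ++ ys)) ≡ fromℕ (length xs) + fromℕ (length ys)
fromℕ-length-++ xs ys = trans (cong fromℕ (List.length-++ xs)) (fromℕ-+ (length xs) (length ys))

length-children≤2 : ∀ {m} (row S : Vec Bool m) → length (children row S) ≤ℕ 2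
length-children≤2 row S with conflict S row
... | true  = ℕ.s≤s ℕ.z≤n
... | false = ℕ.≤-refl

length-concatMap-children : ∀ {m} (row : Vec Bool m) Ls →
  length (concatMap (children row) Ls) ≤ℕ 2 ℕ.* length Ls
length-concatMap-children row []       = ℕ.z≤n
length-concatMap-children row (S ∷ Ls) = begin
  length (children row S ++ concatMap (children row) Ls)           ≡⟨ List.length-++ (children row S) ⟩
  length (children row S) ℕ.+ length (concatMap (children row) Ls) ≤⟨ ℕ.+-mono-≤ (length-children≤2 row S)
                                                                         (length-concatMap-children row Ls) ⟩
  2 ℕ.+ 2 ℕ.* length Ls                                            ≡⟨ ℕ.*-suc 2 (length Ls) ⟨
  2 ℕ.* suc (length Ls)                                            ∎
  where open ℕ.≤-Reasoning

length-levelNodes≤2^ : ∀ {n} (G : Graph n) → length (levelNodes G) ≤ℕ 2 ℕ.^ n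
length-levelNodes≤2^ {zero}  _         = ℕ.≤-refl
length-levelNodes≤2^ {suc n} (G , row) =
  ℕ.≤-trans (length-concatMap-children row (levelNodes G)) (ℕ.*-monoʳ-≤ 2 (length-levelNodes≤2^ G))

length-levelNodes≤treeSize : ∀ {n} (G : Graph n) → length (levelNodes G) ≤ℕ treeSize G
length-levelNodes≤treeSize {zero}  _         = ℕ.≤-refl
length-levelNodes≤treeSize {suc n} (G , row) = ℕ.m≤n+m _ (treeSize G)

treeSize≤4^ : ∀ {n} (G : Graph n) → treeSize G ≤ℕ 4 ℕ.^ n
treeSize≤4^ {zero}  _         = ℕ.≤-refl
treeSize≤4^ {suc n} (G , row) = begin
  treeSize G ℕ.+ length (levelNodes (G , row)) ≤⟨ ℕ.+-mono-≤ (treeSize≤4^ G) (length-levelNodes≤2^ (G , row)) ⟩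
  4 ℕ.^ n ℕ.+ 2 ℕ.* 2 ℕ.^ n                    ≤⟨ ℕ.+-monoʳ-≤ (4 ℕ.^ n) (ℕ.*-monoʳ-≤ 2 2^n≤4^n) ⟩
  4 ℕ.^ n ℕ.+ 2 ℕ.* 4 ℕ.^ n                    ≤⟨ ℕ.+-monoʳ-≤ (4 ℕ.^ n) (ℕ.*-monoˡ-≤ (4 ℕ.^ n) (ℕ.n≤1+n 2)) ⟩
  4 ℕ.* 4 ℕ.^ n                                ∎
  where
  open ℕ.≤-Reasoning
  2^n≤4^n : 2 ℕ.^ n ≤ℕ 4 ℕ.^ n
  2^n≤4^n = ℕ.^-monoˡ-≤ n (ℕ.s≤s (ℕ.s≤s ℕ.z≤n))

-- Expected size of the search tree on G(n,p)

module RandomGraph (p : ℚ) (0≤p : 0ℚ ≤ p) (p≤1 : p ≤ 1ℚ) where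

  q : ℚ
  q = 1ℚ - p

  0≤q : 0ℚ ≤ q
  0≤q = p≤1⇒0≤1-p p≤1

  q≤1 : q ≤ 1ℚ
  q≤1 = 0≤p⇒1-p≤1 0≤p

  q*x+p*x≡x : ∀ x → q * x + p * x ≡ x
  q*x+p*x≡x x = solve 2 (λ p x → (con 1ℚ :- p) :* x :+ p :* x := x) refl p x
    where open +-*-Solver

  rowWeight-nonNeg : ∀ {m} (row : Vec Bool m) → 0ℚ ≤ rowWeight p row
  rowWeight-nonNeg []            = nonNegative⁻¹ 1ℚ
  rowWeight-nonNeg (true  ∷ row) = *-nonNeg 0≤p (rowWeight-nonNeg row)
  rowWeight-nonNeg (false ∷ row) = *-nonNeg 0≤q (rowWeight-nonNeg row)

  graphWeight-nonNeg : ∀ {m} (G : Graph m) → 0ℚ ≤ graphWeight p G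
  graphWeight-nonNeg {zero}  _         = nonNegative⁻¹ 1ℚ
  graphWeight-nonNeg {suc m} (G , row) = *-nonNeg (graphWeight-nonNeg G) (rowWeight-nonNeg row)

  module Row (m : ℕ) = Weighted (rowWeight p {m}) (allVecs m)
  module Gnp (m : ℕ) = Weighted (graphWeight p {m}) (allGraphs m)

  Row-suc : ∀ m f → Row.𝔼 (suc m) f ≡ Row.𝔼 m (λ row → q * f (false ∷ row) + p * f (true ∷ row))
  Row-suc m f = trans (∑-concatMap _ (allVecs m) _) (∑-cong (allVecs m) λ row →
    solve 5 (λ q p w F T → q :* w :* F :+ (p :* w :* T :+ con 0ℚ) := w :* (q :* F :+ p :* T))
      refl q p (rowWeight p row) (f (false ∷ row)) (f (true ∷ row)))
    where open +-*-Solver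

  Gnp-suc : ∀ m f → Gnp.𝔼 (suc m) f ≡ Gnp.𝔼 m (λ G → Row.𝔼 m (λ row → f (G , row)))
  Gnp-suc m f = trans (∑-concatMap _ (allGraphs m) _) (∑-cong (allGraphs m) λ G → begin
    ∑ (map (G ,_) (allVecs m)) (λ H → graphWeight p H * f H)
      ≡⟨ ∑-map (G ,_) (allVecs m) _ ⟩
    ∑ (allVecs m) (λ row → graphWeight p G * rowWeight p row * f (G , row))
      ≡⟨ ∑-cong (allVecs m) (λ row → *-assoc (graphWeight p G) (rowWeight p row) (f (G , row))) ⟩
    ∑ (allVecs m) (λ row → graphWeight p G * (rowWeight p row * f (G , row)))
      ≡⟨ ∑-*ˡ (allVecs m) (graphWeight p G) _ ⟩
    graphWeight p G * Row.𝔼 m (λ row → f (G , row))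
      ∎)
    where open ≡-Reasoning

  Row-const : ∀ m c → Row.𝔼 m (λ _ → c) ≡ c
  Row-const zero    c = trans (+-identityʳ (1ℚ * c)) (*-identityˡ c)
  Row-const (suc m) c = trans (Row-suc m _) (trans (Row.𝔼-cong m λ _ → q*x+p*x≡x c) (Row-const m c))

  Gnp-const : ∀ m c → Gnp.𝔼 m (λ _ → c) ≡ c
  Gnp-const zero    c = trans (+-identityʳ (1ℚ * c)) (*-identityˡ c)
  Gnp-const (suc m) c = trans (Gnp-suc m _) (trans (Gnp.𝔼-cong m λ _ → Row-const m c) (Gnp-const m c))

  q^m≤𝔼-addable : ∀ m (S : Vec Bool m) → q ^ m ≤ Row.𝔼 m (𝟙 ∘ addable S)
  q^m≤𝔼-addable zero    []          = ≤-refl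
  q^m≤𝔼-addable (suc m) (false ∷ S) = begin
    q * q ^ m                                                        ≤⟨ *-monoʳ-≤-0≤ (^-nonNeg m 0≤q) q≤1 ⟩
    1ℚ * q ^ m                                                       ≡⟨ *-identityˡ (q ^ m) ⟩
    q ^ m                                                            ≤⟨ q^m≤𝔼-addable m S ⟩
    Row.𝔼 m (𝟙 ∘ addable S)                                          ≡⟨ Row.𝔼-cong m (q*x+p*x≡x ∘ 𝟙 ∘ addable S) ⟨
    Row.𝔼 m (λ row → q * 𝟙 (addable S row) + p * 𝟙 (addable S row)) ≡⟨ Row-suc m _ ⟨
    Row.𝔼 (suc m) (𝟙 ∘ addable (false ∷ S))                          ∎
    where open ≤-Reasoning
  q^m≤𝔼-addable (suc m) (true ∷ S) = begin
    q * q ^ m                                           ≤⟨ *-monoˡ-≤-0≤ 0≤q (q^m≤𝔼-addable m S) ⟩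
    q * Row.𝔼 m (𝟙 ∘ addable S)                         ≡⟨ Row.𝔼-*ˡ m q (𝟙 ∘ addable S) ⟨
    Row.𝔼 m (λ row → q * 𝟙 (addable S row))             ≡⟨ Row.𝔼-cong m (q*x+p*0≡q*x ∘ 𝟙 ∘ addable S) ⟨
    Row.𝔼 m (λ row → q * 𝟙 (addable S row) + p * 0ℚ)    ≡⟨ Row-suc m _ ⟨
    Row.𝔼 (suc m) (𝟙 ∘ addable (true ∷ S))              ∎
    where
    open ≤-Reasoning
    q*x+p*0≡q*x : ∀ x → q * x + p * 0ℚ ≡ q * x
    q*x+p*0≡q*x x = trans (cong (q * x +_) (*-zeroʳ p)) (+-identityʳ (q * x))

  1+q^m≤𝔼-children : ∀ m (S : Vec Bool m) → 1ℚ + q ^ m ≤ Row.𝔼 m (λ row → fromℕ (length (children row S)))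
  1+q^m≤𝔼-children m S = begin
    1ℚ + q ^ m                                        ≤⟨ +-monoʳ-≤ 1ℚ (q^m≤𝔼-addable m S) ⟩
    1ℚ + Row.𝔼 m (𝟙 ∘ addable S)                      ≡⟨ cong (_+ Row.𝔼 m (𝟙 ∘ addable S)) (Row-const m 1ℚ) ⟨
    Row.𝔼 m (λ _ → 1ℚ) + Row.𝔼 m (𝟙 ∘ addable S)      ≡⟨ Row.𝔼-+ m _ _ ⟨
    Row.𝔼 m (λ row → 1ℚ + 𝟙 (addable S row))          ≡⟨ Row.𝔼-cong m (λ row → fromℕ-length-children row S) ⟨
    Row.𝔼 m (λ row → fromℕ (length (children row S))) ∎
    where open ≤-Reasoning

  *-length≤𝔼-nextLevel : ∀ m {a} → a ≤ 1ℚ + q ^ m → (Ls : List (Vec Bool m)) →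
    a * fromℕ (length Ls) ≤ Row.𝔼 m (λ row → fromℕ (length (concatMap (children row) Ls)))
  *-length≤𝔼-nextLevel m {a} _ [] = ≤-reflexive (trans (*-zeroʳ a) (sym (Row-const m 0ℚ)))
  *-length≤𝔼-nextLevel m {a} a≤1+q^m (S ∷ Ls) = begin
    a * fromℕ (1 ℕ.+ length Ls)                   ≡⟨ cong (a *_) (fromℕ-+ 1 (length Ls)) ⟩
    a * (1ℚ + fromℕ (length Ls))                  ≡⟨ *-distribˡ-+ a 1ℚ _ ⟩
    a * 1ℚ + a * fromℕ (length Ls)                ≤⟨ +-mono-≤ a≤𝔼-children (*-length≤𝔼-nextLevel m a≤1+q^m Ls) ⟩
    Row.𝔼 m (λ row → fromℕ (length (children row S)))
      + Row.𝔼 m (λ row → fromℕ (length (concatMap (children row) Ls)))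
                                                  ≡⟨ Row.𝔼-+ m _ _ ⟨
    Row.𝔼 m (λ row → fromℕ (length (children row S)) + fromℕ (length (concatMap (children row) Ls)))
                                                  ≡⟨ Row.𝔼-cong m (λ row → fromℕ-length-++ (children row S) _) ⟨
    Row.𝔼 m (λ row → fromℕ (length (concatMap (children row) (S ∷ Ls))))
                                                  ∎
    where
    open ≤-Reasoning
    a≤𝔼-children : a * 1ℚ ≤ Row.𝔼 m (λ row → fromℕ (length (children row S)))
    a≤𝔼-children = ≤-trans (≤-reflexive (*-identityʳ a)) (≤-trans a≤1+q^m (1+q^m≤𝔼-children m S))

  [1+q^n]^m≤𝔼-levelSize : ∀ n m → m ≤ℕ n → (1ℚ + q ^ n) ^ m ≤ Gnp.𝔼 m levelSize
  [1+q^n]^m≤𝔼-levelSize n zero    _   = ≤-refl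
  [1+q^n]^m≤𝔼-levelSize n (suc m) m<n = begin
    a * a ^ m                                             ≤⟨ *-monoˡ-≤-0≤ 0≤a ([1+q^n]^m≤𝔼-levelSize n m (ℕ.<⇒≤ m<n)) ⟩
    a * Gnp.𝔼 m levelSize                                 ≡⟨ Gnp.𝔼-*ˡ m a levelSize ⟨
    Gnp.𝔼 m (λ G → a * levelSize G)                       ≤⟨ Gnp.𝔼-mono-≤ m graphWeight-nonNeg (λ G →
                                                               *-length≤𝔼-nextLevel m a≤1+q^m (levelNodes G)) ⟩
    Gnp.𝔼 m (λ G → Row.𝔼 m (λ row → levelSize (G , row))) ≡⟨ Gnp-suc m levelSize ⟨
    Gnp.𝔼 (suc m) levelSize                               ∎
    where
    open ≤-Reasoning
    a = 1ℚ + q ^ n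
    0≤a : 0ℚ ≤ a
    0≤a = ≤-trans (nonNegative⁻¹ 1ℚ) (p≤p+q (^-nonNeg n 0≤q))
    a≤1+q^m : a ≤ 1ℚ + q ^ m
    a≤1+q^m = +-monoʳ-≤ 1ℚ (^-antimonoʳ-≤ 0≤q q≤1 (ℕ.<⇒≤ m<n))

  [1+q^n]^n≤𝕋 : ∀ n → (1ℚ + q ^ n) ^ n ≤ 𝕋 n p
  [1+q^n]^n≤𝕋 n = ≤-trans ([1+q^n]^m≤𝔼-levelSize n n ℕ.≤-refl)
    (Gnp.𝔼-mono-≤ n graphWeight-nonNeg λ G → fromℕ-mono-≤ (length-levelNodes≤treeSize G))

  𝕋≤4^n : ∀ n → 𝕋 n p ≤ fromℕ 4 ^ n
  𝕋≤4^n n = begin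
    𝕋 n p                            ≤⟨ Gnp.𝔼-mono-≤ n graphWeight-nonNeg (λ G → fromℕ-mono-≤ (treeSize≤4^ G)) ⟩
    Gnp.𝔼 n (λ _ → fromℕ (4 ℕ.^ n)) ≡⟨ Gnp-const n _ ⟩
    fromℕ (4 ℕ.^ n)                  ≡⟨ fromℕ-^ 4 n ⟩
    fromℕ 4 ^ n                      ∎
    where open ≤-Reasoning

-- Edge probability k/n

module _ (K : ℕ) .{{_ : NonZero K}} {n : ℕ} {p : ℚ} (0≤p : 0ℚ ≤ p) (np≤K : fromℕ n * p ≤ fromℕ K) where

  private
    D : ℕ
    D = 2 ℕ.* K

    instance
      D≢0 : NonZero D
      D≢0 = ℕ.m*n≢0 2 K

  fromℕ-*-≤½ : ∀ x → x ℕ.* D ≤ℕ n → fromℕ x * p ≤ ½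
  fromℕ-*-≤½ x xD≤n = *-cancelˡ-≤-pos (fromℕ D) {{normalize-pos D 1}} (begin
    fromℕ D * (fromℕ x * p)  ≡⟨ *-assoc (fromℕ D) (fromℕ x) p ⟨
    fromℕ D * fromℕ x * p    ≡⟨ cong (_* p) (trans (*-comm (fromℕ D) (fromℕ x)) (sym (fromℕ-* x D))) ⟩
    fromℕ (x ℕ.* D) * p      ≤⟨ *-monoʳ-≤-0≤ 0≤p (fromℕ-mono-≤ xD≤n) ⟩
    fromℕ n * p              ≤⟨ np≤K ⟩
    fromℕ K                  ≡⟨ solve 1 (λ k → k := con (fromℕ 2) :* k :* con ½) refl (fromℕ K) ⟩
    fromℕ 2 * fromℕ K * ½    ≡⟨ cong (_* ½) (fromℕ-* 2 K) ⟨
    fromℕ D * ½              ∎)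
    where
    open ≤-Reasoning
    open +-*-Solver

  p≤½ : D ≤ℕ n → p ≤ ½
  p≤½ D≤n = ≤-trans (≤-reflexive (sym (*-identityˡ p)))
                    (fromℕ-*-≤½ 1 (subst (_≤ℕ n) (sym (ℕ.*-identityˡ D)) D≤n))

  ¼^[2K]≤[1-p]^n : D ≤ℕ n → ¼ ^ D ≤ (1ℚ - p) ^ n
  ¼^[2K]≤[1-p]^n D≤n = begin
    ¼ ^ D              ≤⟨ ^-monoˡ-≤ D (nonNegative⁻¹ ¼) ¼≤q^[t+1] ⟩
    (q ^ suc t) ^ D    ≡⟨ ^-*-assoc (suc t) D ⟩
    q ^ (suc t ℕ.* D)  ≤⟨ ^-antimonoʳ-≤ 0≤q (0≤p⇒1-p≤1 0≤p) n≤[t+1]D ⟩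
    q ^ n              ∎
    where
    open ≤-Reasoning
    q = 1ℚ - p
    t = n ℕ./ D
    ½≤q : ½ ≤ q
    ½≤q = p≤½⇒½≤1-p (p≤½ D≤n)
    0≤q : 0ℚ ≤ q
    0≤q = ≤-trans (nonNegative⁻¹ ½) ½≤q
    ½≤q^t : ½ ≤ q ^ t
    ½≤q^t = ≤-trans (p≤½⇒½≤1-p (fromℕ-*-≤½ t (m/n*n≤m n D))) (bernoulli 0≤p (≤-trans (p≤½ D≤n) ½≤1) t)
    ¼≤q^[t+1] : ¼ ≤ q ^ suc t
    ¼≤q^[t+1] = *-mono-≤-0≤ (nonNegative⁻¹ ½) (nonNegative⁻¹ ½) ½≤q ½≤q^t
    n≤[t+1]D : n ≤ℕ suc t ℕ.* D
    n≤[t+1]D = ℕ.≤-trans (ℕ.≤-reflexive (m≡m%n+[m/n]*n n D)) (ℕ.+-monoˡ-≤ (t ℕ.* D) (ℕ.<⇒≤ (m%n<n n D)))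

kOver-nonNeg : ∀ {k} → 0ℚ ≤ k → ∀ n → 0ℚ ≤ kOver k n
kOver-nonNeg _   zero    = ≤-refl
kOver-nonNeg 0≤k (suc m) = *-nonNeg 0≤k (nonNegative⁻¹ _ {{normalize-nonNeg 1 (suc m)}})

n*kOver≤k : ∀ {k} → 0ℚ ≤ k → ∀ n → fromℕ n * kOver k n ≤ k
n*kOver≤k     0≤k zero    = 0≤k
n*kOver≤k {k} _   (suc m) = ≤-reflexive (begin
  fromℕ (suc m) * (k * (ℤ.+ 1 / suc m))  ≡⟨ *-leftComm (fromℕ (suc m)) k _ ⟩
  k * (fromℕ (suc m) * (ℤ.+ 1 / suc m))  ≡⟨ cong (k *_) (trans (*-comm (fromℕ (suc m)) _) ([1/n]*n≡1 m)) ⟩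
  k * 1ℚ                                 ≡⟨ *-identityʳ k ⟩
  k                                      ∎)
  where open ≡-Reasoning

lemma3 : (k : ℚ) → 0ℚ < k →
    Σ ℚ λ c → Σ ℚ λ d → 1ℚ < c × Σ ℕ λ N → (n : ℕ) → N ≤ℕ n →
      (c ^ n ≤ 𝕋 n (kOver k n)) × (𝕋 n (kOver k n) ≤ d ^ n)
lemma3 k 0<k with archimedean k
... | K₀ , k≤K₀ = c , fromℕ 4 , 1<c , D , bounds
  where
  K = suc K₀
  D = 2 ℕ.* K
  c = 1ℚ + ¼ ^ D
  1<c : 1ℚ < c
  1<c = <-respˡ-≡ (+-identityʳ 1ℚ) (+-monoʳ-< 1ℚ (^-pos D (positive⁻¹ ¼)))
  bounds : (n : ℕ) → D ≤ℕ n → (c ^ n ≤ 𝕋 n (kOver k n)) × (𝕋 n (kOver k n) ≤ fromℕ 4 ^ n)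
  bounds n D≤n = lower , 𝕋≤4^n n
    where
    p = kOver k n
    0≤k = <⇒≤ 0<k
    0≤p = kOver-nonNeg 0≤k n
    np≤K = ≤-trans (n*kOver≤k 0≤k n) (≤-trans k≤K₀ (fromℕ-mono-≤ (ℕ.n≤1+n K₀)))
    open RandomGraph p 0≤p (≤-trans (p≤½ K 0≤p np≤K D≤n) ½≤1)
    lower : c ^ n ≤ 𝕋 n p
    lower = ≤-trans (^-monoˡ-≤ n (<⇒≤ (<-trans (positive⁻¹ 1ℚ) 1<c))
                                 (+-monoʳ-≤ 1ℚ (¼^[2K]≤[1-p]^n K 0≤p np≤K D≤n)))
                    ([1+q^n]^n≤𝕋 n)
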